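{- Let $\mathcal C$ be a countably infinite collection of functions from $\omega$ to $\omega$. Then there is a function $s:\omega\to\omega+1$ such that for every finite partial function $\sigma$ from $\omega$ to $\omega$ with $\sigma(i)\neq s(i)$ for all $i\in\mathrm{dom}\,\sigma$, $\sigma$ is $\mathcal C$-free, i.e. there are infinitely many $g\in\mathcal C$ with $g\cap\sigma=\emptyset$.
   Context: Functions are regarded as sets of ordered pairs, so $g\cap\sigma=\emptyset$ means $g(i)\neq\sigma(i)$ for all $i\in\mathrm{dom}\,\sigma$. -}

module Defs where

open import Data.Nat using (ℕ; _≤_)
open import Data.Maybe using (Maybe; just; nothing)
open import Data.Product using (_×_; _,_; ∃-syntax)
open import Data.List using (List)
open import Data.List.Membership.Propositional using (_∈_)
open import Relation.Binary.PropositionalEquality using (_≡_; _≢_)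
open import Relation.Nullary using (¬_)

-- A countably infinite collection C of functions ω → ω, given by an
-- enumeration ℕ → (ℕ → ℕ) that is injective: distinct indices give
-- (extensionally) distinct functions.
IsCountablyInfiniteEnum : (ℕ → (ℕ → ℕ)) → Set
IsCountablyInfiniteEnum C =
  ∀ m n → m ≢ n → ¬ (∀ x → C m x ≡ C n x)

-- ω + 1 : 'just k' is k ∈ ω, 'nothing' is the top element ω.
ω+1 : Set
ω+1 = Maybe ℕ

-- A finite partial function ω ⇀ ω, as a finite list of pairs (i , σ(i)).
FinPartial : Set
FinPartial = List (ℕ × ℕ)

IsFunctional : FinPartial → Set
IsFunctional σ = ∀ {i a b} → (i , a) ∈ σ → (i , b) ∈ σ → a ≡ b

Disjoint : (ℕ → ℕ) → FinPartial → Set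
Disjoint g σ = ∀ {i a} → (i , a) ∈ σ → g i ≢ a

AvoidsS : (ℕ → ω+1) → FinPartial → Set
AvoidsS s σ = ∀ {i a} → (i , a) ∈ σ → s i ≢ just a

-- σ is C-free: infinitely many g ∈ C with g ∩ σ = ∅.  Since the
-- enumeration is injective, this is: infinitely many indices n.
CFree : (ℕ → (ℕ → ℕ)) → FinPartial → Set
CFree C σ = ∀ N → ∃[ n ] (N ≤ n × Disjoint (C n) σ)

-- Build s one coordinate at a time while shrinking an infinite set of
-- indices of C.  At coordinate i, if some value a is taken at i by
-- infinitely many surviving indices, set s(i) = a and keep only those
-- indices; otherwise set s(i) = ω and keep them all, since then every value
-- is taken at i by only finitely many of them.  Either way, σ(i) ≠ s(i)
-- excludes only finitely many indices at the stage after i, and the finitely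
-- many coordinates of σ are all handled at one stage, which is still infinite.
module Submission where

open import Defs
open import Level using (0ℓ)
open import Function using (_∘_)
open import Data.Nat using (ℕ; zero; suc; _≤_; _≤′_; _⊔_)
open import Data.Nat.Base using (≤′-refl; ≤′-step)
open import Data.Nat.Properties using (≤-refl; ≤-trans; ≤⇒≤′; m≤m⊔n; m≤n⊔m)
open import Data.Product using (∃-syntax; _×_; _,_; proj₁)
open import Data.Maybe using (just; nothing)
open import Data.Unit using (⊤; tt)
open import Data.List using ([]; _∷_)
open import Data.List.Relation.Unary.Any using (here; there)
open import Relation.Nullary using (¬_; yes; no)
open import Relation.Binary.PropositionalEquality using (_≡_; _≢_; refl; sym; trans; cong)
open import Axiom.ExcludedMiddle using (ExcludedMiddle)
open import Axiom.DoubleNegationElimination using (em⇒dne)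

Infinite : (ℕ → Set) → Set
Infinite P = ∀ N → ∃[ n ] (N ≤ n × P n)

Eventually : (ℕ → Set) → Set
Eventually P = ∃[ N ] (∀ n → N ≤ n → P n)

module _ {P Q : ℕ → Set} where

  eventually-mono : (∀ {n} → P n → Q n) → Eventually P → Eventually Q
  eventually-mono P⇒Q (N , ev) = N , λ n N≤n → P⇒Q (ev n N≤n)

  eventually-× : Eventually P → Eventually Q → Eventually (λ n → P n × Q n)
  eventually-× (M , evP) (N , evQ) =
    M ⊔ N , λ n M⊔N≤n → evP n (≤-trans (m≤m⊔n M N) M⊔N≤n)
                      , evQ n (≤-trans (m≤n⊔m M N) M⊔N≤n)

  infinite-eventually : Infinite P → Eventually (λ n → P n → Q n) → Infinite Q
  infinite-eventually inf (M , ev) N with inf (N ⊔ M)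
  ... | n , N⊔M≤n , p = n , ≤-trans (m≤m⊔n N M) N⊔M≤n , ev n (≤-trans (m≤n⊔m N M) N⊔M≤n) p

¬infinite⇒eventually¬ : ExcludedMiddle 0ℓ → {P : ℕ → Set} →
                        ¬ Infinite P → Eventually (¬_ ∘ P)
¬infinite⇒eventually¬ em {P} ¬inf = dne λ ¬ev → ¬inf λ N →
  dne λ ¬later → ¬ev (N , λ n N≤n p → ¬later (n , N≤n , p))
  where
  dne : ∀ {A : Set} → ¬ ¬ A → A
  dne = em⇒dne em

antitone : (P : ℕ → Set) → (∀ {i} → P (suc i) → P i) →
           ∀ {i j} → i ≤ j → P j → P i
antitone P step = go ∘ ≤⇒≤′
  where
  go : ∀ {i j} → i ≤′ j → P j → P i
  go ≤′-refl        p = p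
  go (≤′-step i≤′j) p = go i≤′j (step p)

record Refinement (X : ℕ → Set) (f : ℕ → ℕ) : Set₁ where
  field
    value               : ω+1
    Y                   : ℕ → Set
    Y⊆X                 : ∀ {n} → Y n → X n
    Y-infinite          : Infinite X → Infinite Y
    avoids-other-values : ∀ a → value ≢ just a → Eventually (λ n → Y n → f n ≢ a)

refine : ExcludedMiddle 0ℓ → (X : ℕ → Set) (f : ℕ → ℕ) → Refinement X f
refine em X f with em {∃[ a ] Infinite (λ n → X n × f n ≡ a)}
... | yes (a , inf) = record
  { value               = just a
  ; Y                   = λ n → X n × f n ≡ a
  ; Y⊆X                 = proj₁
  ; Y-infinite          = λ _ → inf
  ; avoids-other-values = λ b a≢b →
      0 , λ where n _ (_ , fn≡a) fn≡b → a≢b (cong just (trans (sym fn≡a) fn≡b))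
  }
... | no ¬recurring = record
  { value               = nothing
  ; Y                   = X
  ; Y⊆X                 = λ x → x
  ; Y-infinite          = λ inf → inf
  ; avoids-other-values = λ b _ →
      eventually-mono (λ ¬hit x fn≡b → ¬hit (x , fn≡b))
        (¬infinite⇒eventually¬ em (λ inf → ¬recurring (b , inf)))
  }

module Construction (em : ExcludedMiddle 0ℓ) (C : ℕ → (ℕ → ℕ)) where

  -- survivors i: the indices of C kept after coordinates 0, …, i - 1.
  survivors : ℕ → ℕ → Set
  survivors zero    = λ _ → ⊤
  survivors (suc i) = Refinement.Y (refine em (survivors i) (λ n → C n i))

  refinement : ∀ i → Refinement (survivors i) (λ n → C n i)
  refinement i = refine em (survivors i) (λ n → C n i)

  s : ℕ → ω+1
  s i = Refinement.value (refinement i)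

  survivors-infinite : ∀ i → Infinite (survivors i)
  survivors-infinite zero    N = N , ≤-refl , tt
  survivors-infinite (suc i) = Refinement.Y-infinite (refinement i) (survivors-infinite i)

  survivors-antitone : ∀ {i j n} → i ≤ j → survivors j n → survivors i n
  survivors-antitone {n = n} =
    antitone (λ i → survivors i n) (λ {i} → Refinement.Y⊆X (refinement i))

  coordinate-avoids : ∀ {i a} → s i ≢ just a →
                      Eventually (λ n → survivors (suc i) n → C n i ≢ a)
  coordinate-avoids {i} {a} = Refinement.avoids-other-values (refinement i) a

  avoids⇒eventually-disjoint : ∀ σ → AvoidsS s σ →
    ∃[ k ] Eventually (λ n → survivors k n → Disjoint (C n) σ)
  avoids⇒eventually-disjoint [] _ = 0 , 0 , λ _ _ _ ()
  avoids⇒eventually-disjoint ((i , a) ∷ σ) avoids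
    with avoids⇒eventually-disjoint σ (λ a∈σ → avoids (there a∈σ))
  ... | k , disjoint-σ =
    suc i ⊔ k , eventually-mono combine
                  (eventually-× (coordinate-avoids (avoids (here refl))) disjoint-σ)
    where
    combine : ∀ {n} → (survivors (suc i) n → C n i ≢ a) ×
                      (survivors k n → Disjoint (C n) σ) →
              survivors (suc i ⊔ k) n → Disjoint (C n) ((i , a) ∷ σ)
    combine (avoids-i , _) x (here refl) = avoids-i (survivors-antitone (m≤m⊔n (suc i) k) x)
    combine (_ , disjoint) x (there m)   = disjoint (survivors-antitone (m≤n⊔m (suc i) k) x) m

lemma2p4 : ExcludedMiddle 0ℓ → (C : ℕ → (ℕ → ℕ)) → IsCountablyInfiniteEnum C →
    ∃[ s ] (∀ (σ : FinPartial) → IsFunctional σ → AvoidsS s σ → CFree C σ)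
lemma2p4 em C _ = s , free
  where
  open Construction em C

  free : ∀ σ → IsFunctional σ → AvoidsS s σ → CFree C σ
  free σ _ avoids with avoids⇒eventually-disjoint σ avoids
  ... | k , disjoint = infinite-eventually (survivors-infinite k) disjoint
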